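{- Let $F(X,Y)$ be a CNF formula over the disjoint variable sets $X$ and $Y$, and let $F^*(Y)=\mathit{Dis}(F,X)$. Then $F^*(Y)\equiv\exists X.\,F(X,Y)$ if and only if the variables of $X$ are redundant in $F$.
   Context: A point is a complete assignment to $X\cup Y$. For $Z'\subseteq X\cup Y$, a clause is a $Z'$-clause if it contains a variable of $Z'$, and a non-$Z'$-clause otherwise. $\mathit{Dis}(F,X')$ denotes the CNF formula obtained from $F$ by discarding all $X'$-clauses (so $\mathit{Dis}(F,X)$ consists of the clauses of $F$ containing only variables of $Y$). A point $\boldsymbol{p}$ is a $Z'$-boundary point of $F$ if $F(\boldsymbol{p})=0$, every clause of $F$ falsified by $\boldsymbol{p}$ is a $Z'$-clause, and this property fails for every proper subset of $Z'$. A point $\boldsymbol{p}$ is a $Z'$-removable boundary point of $F$ if it is a $Z''$-boundary point for some $Z''\subseteq Z'$ and there is a clause $C$ falsified by $\boldsymbol{p}$ that is a non-$Z'$-clause and is implied by the conjunction of the $Z'$-clauses of $F$. The variables of $X'\subseteq X$ are redundant in $F$ if there is no point that is an $X''$-boundary point of $F$ for some $X''\subseteq X'$ and is also an $X$-removable boundary point of $F$. -}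

module Defs where

open import Data.Nat using (ℕ)
open import Data.Bool using (Bool; true; false)
open import Data.Fin using (Fin)
open import Data.Fin.Subset using (Subset; _∈_; _∉_; _⊆_; _⊂_)
open import Data.Fin.Subset.Properties using (_∈?_)
open import Data.List using (List; filter)
open import Data.List.Membership.Propositional using () renaming (_∈_ to _∈ₗ_)
open import Data.List.Relation.Unary.Any using (Any; any?)
open import Data.List.Relation.Unary.All using (All)
open import Data.Product using (_×_; proj₁; proj₂; Σ; ∃; ∃-syntax)
open import Relation.Nullary using (¬_; ¬?)

open import Relation.Binary.PropositionalEquality using (_≡_)

-- Variables are Fin n; X is a subset of the variables, Y is its complement.
-- A literal is a variable together with its polarity (true = positive).
Literal : ℕ → Set
Literal n = Fin n × Bool

Clause : ℕ → Set
Clause n = List (Literal n)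

CNF : ℕ → Set
CNF n = List (Clause n)

Point : ℕ → Set
Point n = Fin n → Bool

module _ {n : ℕ} where

  LitTrue : Point n → Literal n → Set
  LitTrue p l = p (proj₁ l) ≡ proj₂ l

  ClauseSat : Point n → Clause n → Set
  ClauseSat p C = Any (LitTrue p) C

  CNFSat : Point n → CNF n → Set
  CNFSat p F = All (ClauseSat p) F

  IsZClause : Subset n → Clause n → Set
  IsZClause Z C = Any (λ l → proj₁ l ∈ Z) C

  Dis : CNF n → Subset n → CNF n
  Dis F X' = filter (λ C → ¬? (any? (λ l → proj₁ l ∈? X') C)) F

  FalsifiedAreZ : CNF n → Subset n → Point n → Set
  FalsifiedAreZ F Z p = ∀ C → C ∈ₗ F → ¬ ClauseSat p C → IsZClause Z C

  BoundaryPoint : CNF n → Subset n → Point n → Set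
  BoundaryPoint F Z p =
    ¬ CNFSat p F × FalsifiedAreZ F Z p × (∀ Z'' → Z'' ⊂ Z → ¬ FalsifiedAreZ F Z'' p)

  ZClausesImply : CNF n → Subset n → Clause n → Set
  ZClausesImply F Z C =
    ∀ (q : Point n) → (∀ D → D ∈ₗ F → IsZClause Z D → ClauseSat q D) → ClauseSat q C

  RemovableBoundaryPoint : CNF n → Subset n → Point n → Set
  RemovableBoundaryPoint F Z p =
    (∃[ Z'' ] (Z'' ⊆ Z × BoundaryPoint F Z'' p)) ×
    (∃[ C ] (¬ ClauseSat p C × ¬ IsZClause Z C × ZClausesImply F Z C))

  Redundant : CNF n → Subset n → Subset n → Set
  Redundant F X X' =
    ¬ (∃[ p ] ((∃[ X'' ] (X'' ⊆ X' × BoundaryPoint F X'' p)) × RemovableBoundaryPoint F X p))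

  EquivExists : CNF n → CNF n → Subset n → Set
  EquivExists G F X =
    ∀ (p : Point n) →
      (CNFSat p G → ∃[ q ] ((∀ v → v ∉ X → q v ≡ p v) × CNFSat q F)) ×
      (∃[ q ] ((∀ v → v ∉ X → q v ≡ p v) × CNFSat q F) → CNFSat p G)

-- Write p ≈ q when the points p and q agree on every variable of Y (outside X),
-- and call p extendable when some q ≈ p satisfies F.  Dis(F,X) ≡ ∃X.F says that
-- a point satisfies Dis(F,X) exactly when it is extendable; one direction holds
-- for every F, since the clauses of Dis(F,X) only read Y.
--
-- (⇒) A removable boundary point p below X falsifies only X-clauses, so it
--     satisfies Dis(F,X) and, by the equivalence, has a satisfying q ≈ p.  The
--     non-X-clause C falsified by p is implied by the X-clauses, so q satisfies
--     C, and since C only reads Y, so does p: a contradiction.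
-- (⇐) Points are finitely many, so extendability is decidable.  A point p that
--     satisfies Dis(F,X) but is not extendable falsifies only X-clauses; shrinking
--     X to a minimal such set makes p an X''-boundary point, and the "blocking"
--     clause of p over Y (falsified exactly by the points ≈ p) is implied by the
--     X-clauses.  So p is a removable boundary point, contradicting redundancy.
module Submission where

open import Defs
open import Data.Nat using (ℕ)
open import Data.Bool using (not)
open import Data.Bool.Properties using (not-¬; ¬-not; not-involutive) renaming (_≟_ to _≟ᴮ_)
open import Data.Fin.Properties using () renaming (all? to allFin?)
open import Data.Fin.Subset using (Subset; _∉_; _⊆_; _⊂_)
open import Data.Fin.Subset.Properties using (_∈?_; _⊂?_; ⊆-refl; ⊆-trans; anySubset?)
open import Data.Fin.Subset.Induction using (⊂-wellFounded)
open import Data.Vec using (lookup; tabulate)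
open import Data.Vec.Properties using (lookup∘tabulate)
open import Data.List using (map; filter; allFin)
open import Data.List.Membership.Propositional using (lose) renaming (_∈_ to _∈ₗ_)
open import Data.List.Membership.Propositional.Properties using (∈-filter⁺; ∈-filter⁻; ∈-map⁺; ∈-allFin)
open import Data.List.Relation.Unary.Any as Any using (any?; here; there)
open import Data.List.Relation.Unary.Any.Properties using (map⁻)
open import Data.List.Relation.Unary.All as All using (All; all?; _∷_)
open import Data.List.Relation.Unary.All.Properties using (¬Any⇒All¬; All¬⇒¬Any; all-filter; filter⁺)
open import Data.Product using (_×_; _,_; proj₁; proj₂; ∃; ∃-syntax)
open import Data.Empty using (⊥-elim)
open import Function using (_∘_)
open import Induction.WellFounded using (Acc; acc)
open import Relation.Nullary using (¬_; ¬?; Dec; yes; no)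
open import Relation.Nullary.Decidable using (map′; _×-dec_; _→-dec_)
open import Relation.Unary using (Decidable)
open import Relation.Binary.PropositionalEquality using (_≡_; _≗_; refl; sym; trans)

module _ {n : ℕ} where

  private
    variable
      p q : Point n
      Z W : Subset n
      C D : Clause n

  AgreeOff : Subset n → Point n → Point n → Set
  AgreeOff Z q p = ∀ v → v ∉ Z → q v ≡ p v

  clauseSat? : (p : Point n) → Decidable (ClauseSat p)
  clauseSat? p = any? (λ l → p (proj₁ l) ≟ᴮ proj₂ l)

  cnfSat? : (p : Point n) → Decidable (CNFSat p)
  cnfSat? p = all? (clauseSat? p)

  isZClause? : (Z : Subset n) → Decidable (IsZClause Z)
  isZClause? Z = any? (λ l → proj₁ l ∈? Z)

  agreeOff? : (Z : Subset n) (q p : Point n) → Dec (AgreeOff Z q p)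
  agreeOff? Z q p = allFin? (λ v → ¬? (v ∈? Z) →-dec (q v ≟ᴮ p v))

  clauseSat-transfer : All (λ l → q (proj₁ l) ≡ p (proj₁ l)) C →
                       ClauseSat q C → ClauseSat p C
  clauseSat-transfer (q≡p ∷ _) (here q⊨l) = here (trans (sym q≡p) q⊨l)
  clauseSat-transfer (_ ∷ q≡p) (there q⊨C) = there (clauseSat-transfer q≡p q⊨C)

  clauseSat-agreeOff : ¬ IsZClause Z C → AgreeOff Z q p →
                       ClauseSat q C → ClauseSat p C
  clauseSat-agreeOff {C = C} C∉Z q≈p =
    clauseSat-transfer (All.map (λ {l} → q≈p (proj₁ l)) (¬Any⇒All¬ C C∉Z))

  cnfSat-resp : (F : CNF n) → p ≗ q → CNFSat p F → CNFSat q F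
  cnfSat-resp F p≗q = All.map (clauseSat-transfer (All.tabulate (λ {l} _ → p≗q (proj₁ l))))

  -- Exhaustive search over the 2ⁿ points, representing a point by the subset
  -- of variables it sets to true.
  searchPoint : (P : Point n → Set) → (∀ {p q} → p ≗ q → P p → P q) →
                Decidable P → Dec (∃ P)
  searchPoint P resp P? with anySubset? (P? ∘ lookup)
  ... | yes (s , Ps) = yes (lookup s , Ps)
  ... | no none = no λ (q , Pq) → none (tabulate q , resp (sym ∘ lookup∘tabulate q) Pq)

  minimal-below : (Q : Subset n → Set) → Decidable Q → (Z : Subset n) → Q Z →
                  ∃[ M ] (M ⊆ Z × Q M × (∀ W → W ⊂ M → ¬ Q W))
  minimal-below Q Q? Z = go Z (⊂-wellFounded Z)
    where
    go : ∀ (Z : Subset n) → Acc _⊂_ Z → Q Z → ∃[ M ] (M ⊆ Z × Q M × (∀ W → W ⊂ M → ¬ Q W))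
    go Z (acc smaller) QZ with anySubset? (λ W → (W ⊂? Z) ×-dec Q? W)
    ... | no none = Z , ⊆-refl , QZ , λ W W⊂Z QW → none (W , W⊂Z , QW)
    ... | yes (W , W⊂Z , QW) with go W (smaller W⊂Z) QW
    ...   | M , M⊆W , QM , M-minimal = M , ⊆-trans M⊆W (proj₁ W⊂Z) , QM , M-minimal

  blocking : Subset n → Point n → Clause n
  blocking Z p = map (λ v → v , not (p v)) (filter (λ v → ¬? (v ∈? Z)) (allFin n))

  blocking-falsified : (Z : Subset n) (p : Point n) → ¬ ClauseSat p (blocking Z p)
  blocking-falsified Z p p⊨block with Any.satisfied (map⁻ p⊨block)
  ... | v , p⊨¬v = not-¬ refl p⊨¬v

  blocking-outside : (Z : Subset n) (p : Point n) → ¬ IsZClause Z (blocking Z p)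
  blocking-outside Z p =
    All¬⇒¬Any (all-filter (λ v → ¬? (v ∈? Z)) (allFin n)) ∘ map⁻

  blocking-agreeOff : ∀ {Z p q} → ¬ ClauseSat q (blocking Z p) → AgreeOff Z q p
  blocking-agreeOff {Z} {p} {q} q⊭block v v∉Z =
    trans (¬-not q⊭literal) (not-involutive (p v))
    where
    literal∈block : (v , not (p v)) ∈ₗ blocking Z p
    literal∈block = ∈-map⁺ _ (∈-filter⁺ (λ v → ¬? (v ∈? Z)) (∈-allFin v) v∉Z)

    q⊭literal : ¬ q v ≡ not (p v)
    q⊭literal q⊨literal = q⊭block (lose literal∈block q⊨literal)

  module _ (F : CNF n) where

    falsifiedAreZ? : (Z : Subset n) (p : Point n) → Dec (FalsifiedAreZ F Z p)
    falsifiedAreZ? Z p =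
      map′ (λ all C C∈F → All.lookup all C∈F) (λ f → All.tabulate (f _))
           (all? (λ C → ¬? (clauseSat? p C) →-dec isZClause? Z C) F)

    falsifiedAreZ-mono : Z ⊆ W → FalsifiedAreZ F Z p → FalsifiedAreZ F W p
    falsifiedAreZ-mono Z⊆W f C C∈F p⊭C = Any.map Z⊆W (f C C∈F p⊭C)

    boundary-below : ¬ CNFSat p F → FalsifiedAreZ F Z p →
                     ∃[ Z'' ] (Z'' ⊆ Z × BoundaryPoint F Z'' p)
    boundary-below {p} {Z} p⊭F falsified
      with minimal-below (λ W → FalsifiedAreZ F W p) (λ W → falsifiedAreZ? W p) Z falsified
    ... | Z'' , Z''⊆Z , falsified'' , minimal = Z'' , Z''⊆Z , p⊭F , falsified'' , minimal

    module _ (X : Subset n) where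

      dis⁺ : D ∈ₗ F → ¬ IsZClause X D → D ∈ₗ Dis F X
      dis⁺ = ∈-filter⁺ (¬? ∘ isZClause? X)

      dis⁻ : D ∈ₗ Dis F X → D ∈ₗ F × ¬ IsZClause X D
      dis⁻ = ∈-filter⁻ (¬? ∘ isZClause? X)

      dis-sat⇒falsifiedAreX : CNFSat p (Dis F X) → FalsifiedAreZ F X p
      dis-sat⇒falsifiedAreX p⊨Dis C C∈F p⊭C with isZClause? X C
      ... | yes C∈X = C∈X
      ... | no C∉X = ⊥-elim (p⊭C (All.lookup p⊨Dis (dis⁺ C∈F C∉X)))

      falsifiedAreX⇒dis-sat : FalsifiedAreZ F X p → CNFSat p (Dis F X)
      falsifiedAreX⇒dis-sat {p} falsified = All.tabulate λ {D} D∈Dis →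
        let D∈F , D∉X = dis⁻ D∈Dis in
        case-sat D∈F D∉X (clauseSat? p D)
        where
        case-sat : D ∈ₗ F → ¬ IsZClause X D → Dec (ClauseSat p D) → ClauseSat p D
        case-sat _ _ (yes p⊨D) = p⊨D
        case-sat D∈F D∉X (no p⊭D) = ⊥-elim (D∉X (falsified _ D∈F p⊭D))

      dis-sat-agreeOff : AgreeOff X q p → CNFSat q (Dis F X) → CNFSat p (Dis F X)
      dis-sat-agreeOff q≈p q⊨Dis = All.tabulate λ D∈Dis →
        clauseSat-agreeOff (proj₂ (dis⁻ D∈Dis)) q≈p (All.lookup q⊨Dis D∈Dis)

      sat-from-parts : CNFSat q (Dis F X) →
                       (∀ D → D ∈ₗ F → IsZClause X D → ClauseSat q D) → CNFSat q F
      sat-from-parts {q} q⊨Dis q⊨X = All.tabulate λ {D} D∈F → by-kind D∈F (isZClause? X D)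
        where
        by-kind : D ∈ₗ F → Dec (IsZClause X D) → ClauseSat q D
        by-kind D∈F (yes D∈X) = q⊨X _ D∈F D∈X
        by-kind D∈F (no D∉X) = All.lookup q⊨Dis (dis⁺ D∈F D∉X)

      Extendable : Point n → Set
      Extendable p = ∃[ q ] (AgreeOff X q p × CNFSat q F)

      extendable? : (p : Point n) → Dec (Extendable p)
      extendable? p = searchPoint (λ q → AgreeOff X q p × CNFSat q F) resp
                                  (λ q → agreeOff? X q p ×-dec cnfSat? q F)
        where
        resp : ∀ {q r} → q ≗ r → AgreeOff X q p × CNFSat q F → AgreeOff X r p × CNFSat r F
        resp q≗r (q≈p , q⊨F) =
          (λ v v∉X → trans (sym (q≗r v)) (q≈p v v∉X)) , cnfSat-resp F q≗r q⊨F

      extendable⇒dis-sat : Extendable p → CNFSat p (Dis F X)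
      extendable⇒dis-sat (q , q≈p , q⊨F) =
        dis-sat-agreeOff q≈p (filter⁺ (¬? ∘ isZClause? X) q⊨F)

      equiv⇒redundant : EquivExists (Dis F X) F X → Redundant F X X
      equiv⇒redundant equiv
        (p , (X'' , X''⊆X , _ , falsified , _) , _ , C , p⊭C , C∉X , X⇒C) =
        let p⊨Dis = falsifiedAreX⇒dis-sat (falsifiedAreZ-mono X''⊆X falsified)
            q , q≈p , q⊨F = proj₁ (equiv p) p⊨Dis
        in p⊭C (clauseSat-agreeOff C∉X q≈p (X⇒C q (λ D D∈F _ → All.lookup q⊨F D∈F)))

      -- The blocking clause of a non-extendable model of Dis(F,X) is implied by
      -- the X-clauses of F: a model of the X-clauses falsifying it agrees with p
      -- off X, hence also satisfies Dis(F,X), hence F.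
      blocking-implied : CNFSat p (Dis F X) → ¬ Extendable p →
                         ZClausesImply F X (blocking X p)
      blocking-implied {p} p⊨Dis unextendable q q⊨X with clauseSat? q (blocking X p)
      ... | yes q⊨block = q⊨block
      ... | no q⊭block =
        let q≈p = blocking-agreeOff q⊭block
            q⊨Dis = dis-sat-agreeOff (λ v v∉X → sym (q≈p v v∉X)) p⊨Dis
        in ⊥-elim (unextendable (q , q≈p , sat-from-parts q⊨Dis q⊨X))

      unextendable⇒removable : CNFSat p (Dis F X) → ¬ Extendable p →
        (∃[ X'' ] (X'' ⊆ X × BoundaryPoint F X'' p)) × RemovableBoundaryPoint F X p
      unextendable⇒removable {p} p⊨Dis unextendable =
        boundary , boundary ,
        blocking X p , blocking-falsified X p , blocking-outside X p ,
        blocking-implied p⊨Dis unextendable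
        where
        p⊭F : ¬ CNFSat p F
        p⊭F p⊨F = unextendable (p , (λ _ _ → refl) , p⊨F)

        boundary : ∃[ X'' ] (X'' ⊆ X × BoundaryPoint F X'' p)
        boundary = boundary-below p⊭F (dis-sat⇒falsifiedAreX p⊨Dis)

      redundant⇒equiv : Redundant F X X → EquivExists (Dis F X) F X
      redundant⇒equiv redundant p = extend , extendable⇒dis-sat
        where
        extend : CNFSat p (Dis F X) → Extendable p
        extend p⊨Dis with extendable? p
        ... | yes extendable = extendable
        ... | no unextendable =
          ⊥-elim (redundant (p , unextendable⇒removable p⊨Dis unextendable))

corollary1 : (n : ℕ) (X : Subset n) (F : CNF n) →
    (EquivExists (Dis F X) F X → Redundant F X X) × (Redundant F X X → EquivExists (Dis F X) F X)
corollary1 n X F = equiv⇒redundant F X , redundant⇒equiv F X
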